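{- Let $r \geq 2$ be an integer and let $G$ be an $r$-regular graph of order $n$ whose longest induced path has $k$ vertices. Then $k \leq \frac{rn-2}{2r-2}$.
   Context: All graphs are finite and simple. $\mathrm{LIP}(G)$ denotes the number of vertices of a longest induced path in $G$; the hypothesis is $\mathrm{LIP}(G)=k$. -}

module Defs where

open import Data.Nat using (ℕ; suc; _≤_)
open import Data.Bool using (Bool; true; false)
open import Data.Fin using (Fin)
open import Data.List using (List; []; _∷_; length; filter; allFin)
open import Data.List.Relation.Unary.Unique.Propositional using (Unique)
open import Data.List.Relation.Unary.Linked using (Linked)
open import Data.List.Relation.Unary.AllPairs using (AllPairs)
open import Data.Product using (_×_; Σ; ∃)
open import Relation.Binary.PropositionalEquality using (_≡_)
open import Relation.Nullary using (¬_)
open import Data.Bool using (T)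
open import Relation.Nullary.Decidable using (T?)

record Graph (n : ℕ) : Set where
  field
    adj   : Fin n → Fin n → Bool
    sym   : ∀ u v → adj u v ≡ adj v u
    irrefl : ∀ v → adj v v ≡ false

open Graph public

Adj : ∀ {n} → Graph n → Fin n → Fin n → Set
Adj G u v = T (adj G u v)

degree : ∀ {n} → Graph n → Fin n → ℕ
degree G v = length (filter (λ u → T? (adj G v u)) (allFin _))

Regular : ∀ {n} → ℕ → Graph n → Set
Regular r G = ∀ v → degree G v ≡ r

-- Non-adjacency of non-consecutive vertices in a vertex sequence.
-- NonAdjFar G xs : every pair (x_i, x_j) with j ≥ i + 2 is non-adjacent.
NonAdjFar : ∀ {n} → Graph n → List (Fin n) → Set
NonAdjFar G [] = Data.Unit.⊤
  where import Data.Unit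
NonAdjFar G (x ∷ []) = Data.Unit.⊤
  where import Data.Unit
NonAdjFar G (x ∷ y ∷ zs) =
  Data.List.Relation.Unary.All.All (λ z → ¬ Adj G x z) zs × NonAdjFar G (y ∷ zs)
  where import Data.List.Relation.Unary.All

IsInducedPath : ∀ {n} → Graph n → List (Fin n) → Set
IsInducedPath G xs = Unique xs × Linked (Adj G) xs × NonAdjFar G xs

LIP≡ : ∀ {n} → Graph n → ℕ → Set
LIP≡ G k =
  Σ (List _) (λ xs → IsInducedPath G xs × length xs ≡ k)
  × (∀ xs → IsInducedPath G xs → length xs ≤ k)

-- Let P be an induced path on k vertices and Q the remaining n − k vertices.
-- Double counting adjacencies: the k·r adjacencies out of P are the 2(k − 1)
-- inside the induced path plus those into Q, and the latter number at most
-- |Q|·r. Hence k·r ≤ 2(k − 1) + (n − k)·r, which rearranges to the claim.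
module Submission where

open import Defs hiding (sym)
open import Data.Bool using (true; false; if_then_else_)
open import Data.Empty using (⊥-elim)
open import Data.Fin using (Fin) renaming (_≟_ to _≟ᶠ_)
open import Data.List using (List; []; _∷_; length; map; filter; allFin)
open import Data.List.Membership.Propositional.Properties using (∈-filter⁺; ∈-filter⁻; ∈-allFin)
open import Data.List.Membership.Propositional.Properties.WithK using (unique∧set⇒bag)
open import Data.List.Properties using (length-tabulate)
open import Data.List.Relation.Binary.BagAndSetEquality using (∼bag⇒↭)
open import Data.List.Relation.Binary.Permutation.Propositional using (_↭_)
open import Data.List.Relation.Binary.Permutation.Propositional.Properties using (map⁺)
open import Data.List.Relation.Unary.All as All using (All)
open import Data.List.Relation.Unary.Unique.Propositional using (Unique)
open import Data.List.Relation.Unary.Unique.Propositional.Properties using (filter⁺; allFin⁺)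
open import Data.Nat using (ℕ; zero; suc; _+_; _*_; _∸_; _≤_; z≤n; s≤s)
open import Data.Nat.ListAction using (sum)
open import Data.Nat.ListAction.Properties using (sum-↭)
open import Data.Nat.Properties
open import Algebra.Properties.CommutativeSemigroup +-commutativeSemigroup
  using () renaming (interchange to +-interchange; x∙yz≈y∙xz to +-left-comm)
open import Data.Nat.Tactic.RingSolver using (solve)
open import Data.Product using (_,_; proj₂)
open import Data.Unit using (tt)
open import Function.Bundles using (mk⇔)
open import Relation.Nullary using (¬_; yes; no)
open import Relation.Nullary.Decidable using (T?)
open import Relation.Unary using (Pred; Decidable)
open import Relation.Unary.Properties using (∁?)
open import Relation.Binary.PropositionalEquality

module _ {A : Set} where

  ∑ : List A → (A → ℕ) → ℕ
  ∑ xs f = sum (map f xs)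

  ∑-cong : ∀ xs {f g : A → ℕ} → (∀ x → f x ≡ g x) → ∑ xs f ≡ ∑ xs g
  ∑-cong []       f≗g = refl
  ∑-cong (x ∷ xs) f≗g = cong₂ _+_ (f≗g x) (∑-cong xs f≗g)

  ∑-mono-≤ : ∀ xs {f g : A → ℕ} → (∀ x → f x ≤ g x) → ∑ xs f ≤ ∑ xs g
  ∑-mono-≤ []       f≤g = z≤n
  ∑-mono-≤ (x ∷ xs) f≤g = +-mono-≤ (f≤g x) (∑-mono-≤ xs f≤g)

  ∑-const : ∀ xs c → ∑ xs (λ _ → c) ≡ length xs * c
  ∑-const []       c = refl
  ∑-const (x ∷ xs) c = cong (c +_) (∑-const xs c)

  ∑-distrib-+ : ∀ xs (f g : A → ℕ) → ∑ xs (λ x → f x + g x) ≡ ∑ xs f + ∑ xs g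
  ∑-distrib-+ []       f g = refl
  ∑-distrib-+ (x ∷ xs) f g = begin
    f x + g x + ∑ xs (λ y → f y + g y) ≡⟨ cong (f x + g x +_) (∑-distrib-+ xs f g) ⟩
    f x + g x + (∑ xs f + ∑ xs g)      ≡⟨ +-interchange (f x) (g x) (∑ xs f) (∑ xs g) ⟩
    f x + ∑ xs f + (g x + ∑ xs g)      ∎
    where open ≡-Reasoning

  ∑-comm : ∀ xs ys (f : A → A → ℕ) →
           ∑ xs (λ x → ∑ ys (f x)) ≡ ∑ ys (λ y → ∑ xs (λ x → f x y))
  ∑-comm []       ys f = sym (trans (∑-const ys 0) (*-zeroʳ (length ys)))
  ∑-comm (x ∷ xs) ys f = begin
    ∑ ys (f x) + ∑ xs (λ x′ → ∑ ys (f x′))          ≡⟨ cong (∑ ys (f x) +_) (∑-comm xs ys f) ⟩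
    ∑ ys (f x) + ∑ ys (λ y → ∑ xs (λ x′ → f x′ y))  ≡⟨ ∑-distrib-+ ys (f x) _ ⟨
    ∑ ys (λ y → f x y + ∑ xs (λ x′ → f x′ y))       ∎
    where open ≡-Reasoning

  ∑-↭ : ∀ {xs ys} f → xs ↭ ys → ∑ xs f ≡ ∑ ys f
  ∑-↭ f xs↭ys = sum-↭ (map⁺ f xs↭ys)

  ∑-filter-split : ∀ {p} {P : Pred A p} (P? : Decidable P) xs f →
                   ∑ xs f ≡ ∑ (filter P? xs) f + ∑ (filter (∁? P?) xs) f
  ∑-filter-split P? []       f = refl
  ∑-filter-split P? (x ∷ xs) f with P? x
  ... | yes _ = trans (cong (f x +_) (∑-filter-split P? xs f))
                      (sym (+-assoc (f x) (∑ (filter P? xs) f) (∑ (filter (∁? P?) xs) f)))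
  ... | no  _ = trans (cong (f x +_) (∑-filter-split P? xs f))
                      (+-left-comm (f x) (∑ (filter P? xs) f) (∑ (filter (∁? P?) xs) f))

module _ {n : ℕ} where

  open import Data.List.Membership.DecPropositional (_≟ᶠ_ {n}) using (_∈?_; _∉?_)

  outside : List (Fin n) → List (Fin n)
  outside xs = filter (_∉? xs) (allFin n)

  ∑-allFin-split : ∀ {xs} → Unique xs → ∀ f → ∑ (allFin n) f ≡ ∑ xs f + ∑ (outside xs) f
  ∑-allFin-split {xs} uniq f =
    trans (∑-filter-split (_∈? xs) (allFin n) f)
          (cong (_+ ∑ (outside xs) f) (sym (∑-↭ f xs↭inside)))
    where
    xs↭inside : xs ↭ filter (_∈? xs) (allFin n)
    xs↭inside = ∼bag⇒↭ (unique∧set⇒bag uniq (filter⁺ (_∈? xs) (allFin⁺ n))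
      (mk⇔ (∈-filter⁺ (_∈? xs) (∈-allFin _)) (λ v∈ → proj₂ (∈-filter⁻ (_∈? xs) {xs = allFin n} v∈))))

  length-outside : ∀ {xs} → Unique xs → n ≡ length xs + length (outside xs)
  length-outside {xs} uniq = begin
    n                                                ≡⟨ length-tabulate {n = n} (λ i → i) ⟨
    length (allFin n)                                ≡⟨ length≡∑1 (allFin n) ⟩
    ∑ (allFin n) (λ _ → 1)                           ≡⟨ ∑-allFin-split uniq (λ _ → 1) ⟩
    ∑ xs (λ _ → 1) + ∑ (outside xs) (λ _ → 1)        ≡⟨ cong₂ _+_ (length≡∑1 xs) (length≡∑1 (outside xs)) ⟨
    length xs + length (outside xs)                  ∎
    where
    open ≡-Reasoning
    length≡∑1 : ∀ ys → length ys ≡ ∑ ys (λ _ → 1)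
    length≡∑1 ys = sym (trans (∑-const ys 1) (*-identityʳ (length ys)))

module _ {n : ℕ} (G : Graph n) where

  adjℕ : Fin n → Fin n → ℕ
  adjℕ u v = if adj G u v then 1 else 0

  adjℕ-sym : ∀ u v → adjℕ u v ≡ adjℕ v u
  adjℕ-sym u v rewrite Graph.sym G u v = refl

  adjℕ-irrefl : ∀ v → adjℕ v v ≡ 0
  adjℕ-irrefl v rewrite irrefl G v = refl

  adjℕ≤1 : ∀ u v → adjℕ u v ≤ 1
  adjℕ≤1 u v with adj G u v
  ... | true  = s≤s z≤n
  ... | false = z≤n

  ¬Adj⇒adjℕ≡0 : ∀ {u v} → ¬ Adj G u v → adjℕ u v ≡ 0
  ¬Adj⇒adjℕ≡0 {u} {v} ¬uv with adj G u v
  ... | true  = ⊥-elim (¬uv tt)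
  ... | false = refl

  degree≡∑adjℕ : ∀ v → degree G v ≡ ∑ (allFin n) (adjℕ v)
  degree≡∑adjℕ v = go (allFin n)
    where
    go : ∀ us → length (filter (λ u → T? (adj G v u)) us) ≡ ∑ us (adjℕ v)
    go []       = refl
    go (u ∷ us) with adj G v u
    ... | true  = cong suc (go us)
    ... | false = go us

  internalDegreeSum : List (Fin n) → ℕ
  internalDegreeSum xs = ∑ xs (λ u → ∑ xs (adjℕ u))

  internalDegreeSum-∷ : ∀ x xs → internalDegreeSum (x ∷ xs) ≡
    adjℕ x x + ∑ xs (adjℕ x) + (∑ xs (adjℕ x) + internalDegreeSum xs)
  internalDegreeSum-∷ x xs = cong (adjℕ x x + ∑ xs (adjℕ x) +_)
    (trans (∑-distrib-+ xs (λ u → adjℕ u x) (λ u → ∑ xs (adjℕ u)))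
           (cong (_+ internalDegreeSum xs) (∑-cong xs (λ u → adjℕ-sym u x))))

  ∑-adjℕ-nonNeighbours : ∀ {x} zs → All (λ z → ¬ Adj G x z) zs → ∑ zs (adjℕ x) ≡ 0
  ∑-adjℕ-nonNeighbours []       All.[]           = refl
  ∑-adjℕ-nonNeighbours (z ∷ zs) (¬xz All.∷ ¬xzs) =
    trans (cong (_+ ∑ zs _) (¬Adj⇒adjℕ≡0 ¬xz)) (∑-adjℕ-nonNeighbours zs ¬xzs)

  internalDegreeSum-nonAdjFar : ∀ x xs → NonAdjFar G (x ∷ xs) →
                                internalDegreeSum (x ∷ xs) + 2 ≤ 2 * length (x ∷ xs)
  internalDegreeSum-nonAdjFar x []           _ rewrite adjℕ-irrefl x = ≤-refl
  internalDegreeSum-nonAdjFar x (y ∷ zs) (¬xzs , far) = begin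
    internalDegreeSum (x ∷ y ∷ zs) + 2
      ≡⟨ cong (_+ 2) (internalDegreeSum-∷ x (y ∷ zs)) ⟩
    adjℕ x x + d + (d + internalDegreeSum (y ∷ zs)) + 2
      ≡⟨ cong (λ t → t + d + (d + internalDegreeSum (y ∷ zs)) + 2) (adjℕ-irrefl x) ⟩
    d + (d + internalDegreeSum (y ∷ zs)) + 2
      ≡⟨ +-assoc d _ 2 ⟩
    d + (d + internalDegreeSum (y ∷ zs) + 2)
      ≡⟨ cong (d +_) (+-assoc d _ 2) ⟩
    d + (d + (internalDegreeSum (y ∷ zs) + 2))
      ≤⟨ +-mono-≤ d≤1 (+-mono-≤ d≤1 (internalDegreeSum-nonAdjFar y zs far)) ⟩
    1 + (1 + 2 * length (y ∷ zs))
      ≡⟨ *-distribˡ-+ 2 1 (length (y ∷ zs)) ⟨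
    2 * length (x ∷ y ∷ zs) ∎
    where
    open ≤-Reasoning
    d = ∑ (y ∷ zs) (adjℕ x)
    d≤1 : d ≤ 1
    d≤1 = begin
      adjℕ x y + ∑ zs (adjℕ x) ≡⟨ cong (adjℕ x y +_) (∑-adjℕ-nonNeighbours zs ¬xzs) ⟩
      adjℕ x y + 0             ≡⟨ +-identityʳ (adjℕ x y) ⟩
      adjℕ x y                 ≤⟨ adjℕ≤1 x y ⟩
      1                        ∎

  module _ {r : ℕ} (regular : Regular r G) {xs : List (Fin n)} (uniq : Unique xs) where

    degree-split : ∀ u → r ≡ ∑ xs (adjℕ u) + ∑ (outside xs) (adjℕ u)
    degree-split u =
      trans (sym (regular u)) (trans (degree≡∑adjℕ u) (∑-allFin-split uniq (adjℕ u)))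

    cutSize : ℕ
    cutSize = ∑ xs (λ u → ∑ (outside xs) (adjℕ u))

    degreeSum≡internal+cut : length xs * r ≡ internalDegreeSum xs + cutSize
    degreeSum≡internal+cut = begin
      length xs * r                                         ≡⟨ ∑-const xs r ⟨
      ∑ xs (λ _ → r)                                        ≡⟨ ∑-cong xs degree-split ⟩
      ∑ xs (λ u → ∑ xs (adjℕ u) + ∑ (outside xs) (adjℕ u))  ≡⟨ ∑-distrib-+ xs _ _ ⟩
      internalDegreeSum xs + cutSize                        ∎
      where open ≡-Reasoning

    cutSize≤outside*r : cutSize ≤ length (outside xs) * r
    cutSize≤outside*r = begin
      cutSize                                       ≡⟨ ∑-comm xs (outside xs) adjℕ ⟩
      ∑ (outside xs) (λ w → ∑ xs (λ u → adjℕ u w))  ≡⟨ ∑-cong (outside xs) (λ w → ∑-cong xs (λ u → adjℕ-sym u w)) ⟩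
      ∑ (outside xs) (λ w → ∑ xs (adjℕ w))          ≤⟨ ∑-mono-≤ (outside xs) (λ w → subst (_ ≤_) (sym (degree-split w)) (m≤m+n _ _)) ⟩
      ∑ (outside xs) (λ _ → r)                      ≡⟨ ∑-const (outside xs) r ⟩
      length (outside xs) * r                       ∎
      where open ≤-Reasoning

rearrange : ∀ {k q r i c} → k * suc r ≡ i + c → i + 2 ≤ 2 * k → c ≤ q * suc r →
            k * (2 * suc r ∸ 2) + 2 ≤ suc r * (k + q)
rearrange {k} {q} {r} {i} {c} kr≡i+c i+2≤2k c≤qr =
  +-cancelʳ-≤ (2 * k) (k * (2 * suc r ∸ 2) + 2) (suc r * (k + q)) (begin
  k * (2 * suc r ∸ 2) + 2 + 2 * k  ≡⟨ cong (λ t → k * t + 2 + 2 * k) (*-distribˡ-∸ 2 (suc r) 1) ⟨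
  k * (2 * r) + 2 + 2 * k          ≡⟨ expand ⟩
  k * suc r + (k * suc r + 2)      ≡⟨ cong (λ t → k * suc r + (t + 2)) kr≡i+c ⟩
  k * suc r + (i + c + 2)          ≡⟨ cong (k * suc r +_) swap-2 ⟩
  k * suc r + (i + 2 + c)          ≤⟨ +-monoʳ-≤ (k * suc r) (+-mono-≤ i+2≤2k c≤qr) ⟩
  k * suc r + (2 * k + q * suc r)  ≡⟨ collect ⟩
  suc r * (k + q) + 2 * k          ∎)
  where
  open ≤-Reasoning
  expand : k * (2 * r) + 2 + 2 * k ≡ k * suc r + (k * suc r + 2)
  expand = solve (k ∷ r ∷ [])
  swap-2 : i + c + 2 ≡ i + 2 + c
  swap-2 = solve (i ∷ c ∷ [])
  collect : k * suc r + (2 * k + q * suc r) ≡ suc r * (k + q) + 2 * k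
  collect = solve (k ∷ q ∷ r ∷ [])

mainTheorem3 : (r n k : ℕ) → 2 ≤ r → 1 ≤ n → (G : Graph n) → Regular r G → LIP≡ G k →
    k * (2 * r ∸ 2) + 2 ≤ r * n
mainTheorem3 r n zero r≥2 n≥1 G regular _ = *-mono-≤ r≥2 n≥1
-- Any induced path with k vertices gives the bound.
mainTheorem3 (suc r) n (suc k) _ _ G regular ((x ∷ xs , (uniq , _ , far) , refl) , _) =
  subst (λ m → suc k * (2 * suc r ∸ 2) + 2 ≤ suc r * m) (sym (length-outside uniq))
    (rearrange (degreeSum≡internal+cut G regular uniq)
               (internalDegreeSum-nonAdjFar G x xs far)
               (cutSize≤outside*r G regular uniq))
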